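{- Every connected component of the quasi-crystal graph $\Gamma(\mathrm{hypo})$ contains exactly one standard word. Consequently, for all $u,v \in \mathcal{A}^*$, the words $u$ and $v$ lie in the same connected component of $\Gamma(\mathrm{hypo})$ if and only if $\mathrm{std}(u) = \mathrm{std}(v)$.
   Context: $\mathcal{A} = \{1,2,3,\ldots\}$ with the usual order; $\mathcal{A}^*$ is the free monoid over $\mathcal{A}$. A word of length $k$ is standard if it contains each of $1,\ldots,k$ exactly once. The standardization $\mathrm{std}(u)$ of a word $u$ of length $k$ is the standard word obtained by replacing the occurrences of the letter $1$, from left to right, by $1,2,\ldots$, then the occurrences of the letter $2$, from left to right, by the next integers, and so on. For $i \in \mathbb{N}$ the quasi-Kashiwara operators $\ddot e_i, \ddot f_i$ are partial maps on $\mathcal{A}^*$: if $u$ contains a letter $i+1$ somewhere to the left of a letter $i$, both are undefined on $u$; otherwise $\ddot e_i(u)$ replaces the leftmost letter $i+1$ of $u$ by $i$ (undefined if there is none), and $\ddot f_i(u)$ replaces the rightmost letter $i$ of $u$ by $i+1$ (undefined if there is none). The quasi-crystal graph $\Gamma(\mathrm{hypo})$ has vertex set $\mathcal{A}^*$ and an edge $u \to v$ labelled $i$ iff $v = \ddot f_i(u)$; connected components are taken in the underlying undirected graph. -}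

module Defs where

open import Data.Nat using (ℕ; zero; suc; _≤_; _<ᵇ_; _≡ᵇ_)
open import Data.Bool using (Bool; true; false; if_then_else_; _∧_; _∨_)
open import Data.List using (List; []; _∷_; length)
open import Data.List.Relation.Unary.All using (All)
open import Data.Maybe using (Maybe; just; nothing)
open import Data.Product using (_×_; ∃)
open import Relation.Binary.PropositionalEquality using (_≡_)
open import Relation.Binary.Construct.Closure.Equivalence using (EqClosure)

-- Words over ℕ (as lists).  The alphabet 𝒜 = {1,2,3,...} is the set of
-- nonzero naturals; a word of 𝒜* is a list all of whose letters are ≥ 1.
Word : Set
Word = List ℕ

IsWord : Word → Set
IsWord u = All (λ a → 1 ≤ a) u

occ : ℕ → Word → ℕ
occ a [] = 0
occ a (b ∷ w) = if a ≡ᵇ b then suc (occ a w) else occ a w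

occLess : ℕ → Word → ℕ
occLess a [] = 0
occLess a (b ∷ w) = if b <ᵇ a then suc (occLess a w) else occLess a w

IsStandard : Word → Set
IsStandard u = ∀ j → 1 ≤ j → j ≤ length u → occ j u ≡ 1

-- A letter a at some position is replaced by
--   1 + #(letters of u smaller than a) + #(earlier occurrences of a),
-- which is exactly "replace the 1's left to right by 1,2,…, then the
-- 2's by the next integers, and so on".
stdFrom : Word → Word → Word → Word
stdFrom u seen [] = []
stdFrom u seen (a ∷ rest) =
  suc (occLess a u Data.Nat.+ occ a seen) ∷ stdFrom u (a ∷ seen) rest

std : Word → Word
std u = stdFrom u [] u

elemᵇ : ℕ → Word → Bool
elemᵇ x [] = false
elemᵇ x (a ∷ w) = (x ≡ᵇ a) ∨ elemᵇ x w

blocked : ℕ → Word → Bool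
blocked i [] = false
blocked i (a ∷ w) = ((a ≡ᵇ suc i) ∧ elemᵇ i w) ∨ blocked i w

replaceFirst : ℕ → ℕ → Word → Maybe Word
replaceFirst x y [] = nothing
replaceFirst x y (a ∷ w) with x ≡ᵇ a
... | true  = just (y ∷ w)
... | false with replaceFirst x y w
...   | just w' = just (a ∷ w')
...   | nothing = nothing

replaceLast : ℕ → ℕ → Word → Maybe Word
replaceLast x y [] = nothing
replaceLast x y (a ∷ w) with replaceLast x y w
... | just w' = just (a ∷ w')
... | nothing = if x ≡ᵇ a then just (y ∷ w) else nothing

qe : ℕ → Word → Maybe Word
qe i u = if blocked i u then nothing else replaceFirst (suc i) i u

qf : ℕ → Word → Maybe Word
qf i u = if blocked i u then nothing else replaceLast i (suc i) u

Edge : Word → Word → Set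
Edge u v = IsWord u × IsWord v × ∃ λ i → qf i u ≡ just v

SameComponent : Word → Word → Set
SameComponent = EqClosure Edge

-- An edge raises the rightmost letter i of a word to i+1, and exists exactly
-- when no i+1 precedes that letter.  Such a move preserves the relative order
-- of all letters, ties broken from left to right, so std is constant on
-- components; as std fixes standard words, a component contains at most one
-- standard word.  Conversely, by induction on the length: raise the last
-- occurrence of a largest letter of u to a letter H so large that it never
-- interferes with the edges joining the rest of u to its standard word t,
-- then lower H again to length t + 1.  The result is standard.
module Submission where

open import Defs
open import Data.Bool using (true; false)
open import Data.Bool.Properties using (∨-zeroʳ; ∧-zeroʳ; ∨-conicalˡ)
open import Data.List using ([]; _∷_; [_]; _++_; _ʳ++_; length; take; drop)
open import Data.List.Properties using (length-++-sucʳ; take++drop≡id)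
open import Data.List.Relation.Unary.All using (All; []; _∷_; lookup; head; tail)
  renaming (map to All-map)
import Data.List.Relation.Unary.All.Properties as All
open import Data.List.Relation.Unary.Any using (here; there)
open import Data.List.Membership.Propositional using (_∈_)
open import Data.Maybe using (just; nothing)
open import Data.Nat using (ℕ; zero; suc; _+_; _⊔_; _≤_; _<_; _≡ᵇ_; _<ᵇ_; z≤n; s≤s; _≤?_)
open import Data.Nat.Properties
open import Algebra.Properties.CommutativeSemigroup +-commutativeSemigroup
  using (interchange; x∙yz≈y∙xz; xy∙z≈xz∙y)
open import Data.Product using (_×_; Σ; ∃₂; ∃-syntax; _,_; proj₁; proj₂)
open import Data.Sum using (inj₁; inj₂)
open import Function.Base using (_∘_)
open import Function.Bundles using (_⇔_; mk⇔)
open import Relation.Binary.PropositionalEquality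
  using (_≡_; _≢_; refl; sym; trans; cong; cong₂; subst; ≢-sym; module ≡-Reasoning; isEquivalence)
open import Relation.Binary.Construct.Closure.Equivalence
  using (symmetric; transitive; gfold; setoid)
open import Relation.Binary.Construct.Closure.ReflexiveTransitive using (ε; _◅_; _◅◅_)
open import Relation.Binary.Construct.Closure.Symmetric using (SymClosure; fwd; bwd)
open import Relation.Nullary using (yes; no; contradiction)
open import Relation.Nullary.Reflects using (Reflects; ofʸ; ofⁿ; fromEquivalence)

≡ᵇ-reflects : ∀ m n → Reflects (m ≡ n) (m ≡ᵇ n)
≡ᵇ-reflects m n = fromEquivalence (≡ᵇ⇒≡ m n) (≡⇒≡ᵇ m n)

≡ᵇ-refl : ∀ n → (n ≡ᵇ n) ≡ true
≡ᵇ-refl zero    = refl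
≡ᵇ-refl (suc n) = ≡ᵇ-refl n

≢⇒≡ᵇ≡false : ∀ {m n} → m ≢ n → (m ≡ᵇ n) ≡ false
≢⇒≡ᵇ≡false {m} {n} m≢n with m ≡ᵇ n | ≡ᵇ-reflects m n
... | true  | ofʸ m≡n = contradiction m≡n m≢n
... | false | _       = refl

occ-++ : ∀ a xs ys → occ a (xs ++ ys) ≡ occ a xs + occ a ys
occ-++ a []       ys = refl
occ-++ a (b ∷ xs) ys with a ≡ᵇ b
... | true  = cong suc (occ-++ a xs ys)
... | false = occ-++ a xs ys

occ-ʳ++ : ∀ a xs ys → occ a (xs ʳ++ ys) ≡ occ a xs + occ a ys
occ-ʳ++ a []       ys = refl
occ-ʳ++ a (b ∷ xs) ys = begin
  occ a (xs ʳ++ b ∷ ys)               ≡⟨ occ-ʳ++ a xs (b ∷ ys) ⟩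
  occ a xs + occ a (b ∷ ys)           ≡⟨ cong (occ a xs +_) (occ-++ a [ b ] ys) ⟩
  occ a xs + (occ a [ b ] + occ a ys) ≡⟨ +-assoc (occ a xs) _ _ ⟨
  occ a xs + occ a [ b ] + occ a ys   ≡⟨ cong (_+ occ a ys) (+-comm (occ a xs) _) ⟩
  occ a [ b ] + occ a xs + occ a ys   ≡⟨ cong (_+ occ a ys) (occ-++ a [ b ] xs) ⟨
  occ a (b ∷ xs) + occ a ys           ∎
  where open ≡-Reasoning

occ-∷-self : ∀ a w → occ a (a ∷ w) ≡ suc (occ a w)
occ-∷-self a w rewrite ≡ᵇ-refl a = refl

occ-∷-≢ : ∀ {a b} w → a ≢ b → occ a (b ∷ w) ≡ occ a w
occ-∷-≢ w a≢b rewrite ≢⇒≡ᵇ≡false a≢b = refl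

All≢⇒occ≡0 : ∀ {a w} → All (_≢ a) w → occ a w ≡ 0
All≢⇒occ≡0 []                     = refl
All≢⇒occ≡0 {w = _ ∷ w} (b≢a ∷ h) = trans (occ-∷-≢ w (≢-sym b≢a)) (All≢⇒occ≡0 h)

occ≡0⇒All≢ : ∀ {a} w → occ a w ≡ 0 → All (_≢ a) w
occ≡0⇒All≢ []      _ = []
occ≡0⇒All≢ {a} (b ∷ w) e with a ≡ᵇ b | ≡ᵇ-reflects a b
... | true  | _        = contradiction e λ ()
... | false | ofⁿ a≢b = ≢-sym a≢b ∷ occ≡0⇒All≢ w e

occLess-++ : ∀ a xs ys → occLess a (xs ++ ys) ≡ occLess a xs + occLess a ys
occLess-++ a []       ys = refl
occLess-++ a (b ∷ xs) ys with b <ᵇ a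
... | true  = cong suc (occLess-++ a xs ys)
... | false = occLess-++ a xs ys

occLess-0 : ∀ w → occLess 0 w ≡ 0
occLess-0 []      = refl
occLess-0 (_ ∷ w) = occLess-0 w

occLess-suc : ∀ a w → occLess (suc a) w ≡ occLess a w + occ a w
occLess-suc a []      = refl
occLess-suc a (b ∷ w) = begin
  occLess (suc a) (b ∷ w)                                   ≡⟨ occLess-++ (suc a) [ b ] w ⟩
  occLess (suc a) [ b ] + occLess (suc a) w                 ≡⟨ cong₂ _+_ (letter a b) (occLess-suc a w) ⟩
  (occLess a [ b ] + occ a [ b ]) + (occLess a w + occ a w) ≡⟨ interchange (occLess a [ b ]) (occ a [ b ]) (occLess a w) (occ a w) ⟩
  (occLess a [ b ] + occLess a w) + (occ a [ b ] + occ a w) ≡⟨ cong₂ _+_ (occLess-++ a [ b ] w) (occ-++ a [ b ] w) ⟨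
  occLess a (b ∷ w) + occ a (b ∷ w)                         ∎
  where
  open ≡-Reasoning
  letter : ∀ a b → occLess (suc a) [ b ] ≡ occLess a [ b ] + occ a [ b ]
  letter zero    zero    = refl
  letter zero    (suc b) = refl
  letter (suc a) zero    = refl
  letter (suc a) (suc b) = letter a b

occLess≤length : ∀ a w → occLess a w ≤ length w
occLess≤length a []      = z≤n
occLess≤length a (b ∷ w) with b <ᵇ a
... | true  = s≤s (occLess≤length a w)
... | false = m≤n⇒m≤1+n (occLess≤length a w)

occLess≡length⇒All< : ∀ a w → occLess a w ≡ length w → All (_< a) w
occLess≡length⇒All< a []      _ = []
occLess≡length⇒All< a (b ∷ w) e with b <ᵇ a | <ᵇ-reflects-< b a
... | true  | ofʸ b<a = b<a ∷ occLess≡length⇒All< a w (suc-injective e)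
... | false | _       = contradiction (subst (_≤ length w) e (occLess≤length a w)) 1+n≰n

occLess-raise : ∀ a i xs ys →
                occLess a (xs ++ i ∷ ys) ≡ occLess a (xs ++ suc i ∷ ys) + occ a [ suc i ]
occLess-raise a i (x ∷ xs) ys with x <ᵇ a
... | true  = cong suc (occLess-raise a i xs ys)
... | false = occLess-raise a i xs ys
occLess-raise a i []       ys = begin
  occLess a (i ∷ ys)                                    ≡⟨ occLess-++ a [ i ] ys ⟩
  occLess a [ i ] + occLess a ys                        ≡⟨ cong (_+ occLess a ys) (letter a i) ⟩
  occLess a [ suc i ] + occ a [ suc i ] + occLess a ys  ≡⟨ xy∙z≈xz∙y (occLess a [ suc i ]) (occ a [ suc i ]) (occLess a ys) ⟩
  occLess a [ suc i ] + occLess a ys + occ a [ suc i ]  ≡⟨ cong (_+ occ a [ suc i ]) (occLess-++ a [ suc i ] ys) ⟨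
  occLess a (suc i ∷ ys) + occ a [ suc i ]              ∎
  where
  open ≡-Reasoning
  letter : ∀ a i → occLess a [ i ] ≡ occLess a [ suc i ] + occ a [ suc i ]
  letter zero          i       = refl
  letter (suc zero)    zero    = refl
  letter (suc (suc a)) zero    = refl
  letter (suc a)       (suc i) = letter a i

occLess-raise-≢ : ∀ {a i} xs ys → a ≢ suc i →
                  occLess a (xs ++ i ∷ ys) ≡ occLess a (xs ++ suc i ∷ ys)
occLess-raise-≢ {a} {i} xs ys a≢1+i =
  trans (occLess-raise a i xs ys)
        (trans (cong (occLess a (xs ++ suc i ∷ ys) +_) (occ-∷-≢ [] a≢1+i)) (+-identityʳ _))

rank : Word → Word → ℕ → ℕ
rank u seen a = occLess a u + occ a seen

stdFrom-++ : ∀ u seen xs ys →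
             stdFrom u seen (xs ++ ys) ≡ stdFrom u seen xs ++ stdFrom u (xs ʳ++ seen) ys
stdFrom-++ u seen []       ys = refl
stdFrom-++ u seen (x ∷ xs) ys = cong (_ ∷_) (stdFrom-++ u (x ∷ seen) xs ys)

stdFrom-cong : ∀ {u₁ u₂} seen₁ seen₂ w →
               (∀ {a} → a ∈ w → rank u₁ seen₁ a ≡ rank u₂ seen₂ a) →
               stdFrom u₁ seen₁ w ≡ stdFrom u₂ seen₂ w
stdFrom-cong seen₁ seen₂ []      _    = refl
stdFrom-cong {u₁} {u₂} seen₁ seen₂ (b ∷ w) same =
  cong₂ _∷_ (cong suc (same (here refl)))
            (stdFrom-cong (b ∷ seen₁) (b ∷ seen₂) w (see-b ∘ same ∘ there))
  where
  open ≡-Reasoning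
  see-b : ∀ {a} → rank u₁ seen₁ a ≡ rank u₂ seen₂ a → rank u₁ (b ∷ seen₁) a ≡ rank u₂ (b ∷ seen₂) a
  see-b {a} eq = begin
    occLess a u₁ + occ a (b ∷ seen₁)           ≡⟨ cong (occLess a u₁ +_) (occ-++ a [ b ] seen₁) ⟩
    occLess a u₁ + (occ a [ b ] + occ a seen₁) ≡⟨ x∙yz≈y∙xz (occLess a u₁) (occ a [ b ]) (occ a seen₁) ⟩
    occ a [ b ] + rank u₁ seen₁ a              ≡⟨ cong (occ a [ b ] +_) eq ⟩
    occ a [ b ] + rank u₂ seen₂ a              ≡⟨ x∙yz≈y∙xz (occ a [ b ]) (occLess a u₂) (occ a seen₂) ⟩
    occLess a u₂ + (occ a [ b ] + occ a seen₂) ≡⟨ cong (occLess a u₂ +_) (occ-++ a [ b ] seen₂) ⟨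
    occLess a u₂ + occ a (b ∷ seen₂)           ∎

data Raise (i : ℕ) : Word → Word → Set where
  raise : ∀ xs ys → All (_≢ suc i) xs → All (_≢ i) ys → Raise i (xs ++ i ∷ ys) (xs ++ suc i ∷ ys)

std-Raise : ∀ {i u v} → Raise i u v → std u ≡ std v
std-Raise {i} (raise xs ys no-1+i no-i) = begin
  stdFrom u [] (xs ++ i ∷ ys)                   ≡⟨ stdFrom-++ u [] xs (i ∷ ys) ⟩
  stdFrom u [] xs ++ stdFrom u seen (i ∷ ys)     ≡⟨ cong₂ _++_ prefix (cong₂ _∷_ (cong suc raised) suffix) ⟩
  stdFrom v [] xs ++ stdFrom v seen (suc i ∷ ys) ≡⟨ stdFrom-++ v [] xs (suc i ∷ ys) ⟨
  stdFrom v [] (xs ++ suc i ∷ ys)               ∎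
  where
  open ≡-Reasoning
  u = xs ++ i ∷ ys
  v = xs ++ suc i ∷ ys
  seen = xs ʳ++ []
  i≢1+i = ≢-sym 1+n≢n

  prefix : stdFrom u [] xs ≡ stdFrom v [] xs
  prefix = stdFrom-cong [] [] xs λ a∈xs → cong (_+ 0) (occLess-raise-≢ xs ys (lookup no-1+i a∈xs))

  raised : rank u seen i ≡ rank v seen (suc i)
  raised = begin
    occLess i u + occ i seen           ≡⟨ cong₂ _+_ (occLess-raise-≢ xs ys i≢1+i) occ-i ⟩
    occLess i v + occ i v              ≡⟨ occLess-suc i v ⟨
    occLess (suc i) v                  ≡⟨ +-identityʳ _ ⟨
    occLess (suc i) v + 0              ≡⟨ cong (occLess (suc i) v +_) occ-1+i ⟨
    occLess (suc i) v + occ (suc i) seen ∎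
    where
    occ-i : occ i seen ≡ occ i v
    occ-i = begin
      occ i seen                       ≡⟨ occ-ʳ++ i xs [] ⟩
      occ i xs + 0                     ≡⟨ cong (occ i xs +_) (All≢⇒occ≡0 (1+n≢n ∷ no-i)) ⟨
      occ i xs + occ i (suc i ∷ ys)    ≡⟨ occ-++ i xs (suc i ∷ ys) ⟨
      occ i v                          ∎
    occ-1+i : occ (suc i) seen ≡ 0
    occ-1+i = trans (occ-ʳ++ (suc i) xs []) (trans (+-identityʳ _) (All≢⇒occ≡0 no-1+i))

  suffix : stdFrom u (i ∷ seen) ys ≡ stdFrom v (suc i ∷ seen) ys
  suffix = stdFrom-cong (i ∷ seen) (suc i ∷ seen) ys λ a∈ys → shifted (lookup no-i a∈ys)
    where
    shifted : ∀ {a} → a ≢ i → rank u (i ∷ seen) a ≡ rank v (suc i ∷ seen) a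
    shifted {a} a≢i = begin
      occLess a u + occ a (i ∷ seen)              ≡⟨ cong₂ _+_ (occLess-raise a i xs ys) (occ-∷-≢ seen a≢i) ⟩
      occLess a v + occ a [ suc i ] + occ a seen  ≡⟨ +-assoc (occLess a v) (occ a [ suc i ]) (occ a seen) ⟩
      occLess a v + (occ a [ suc i ] + occ a seen) ≡⟨ cong (occLess a v +_) (occ-++ a [ suc i ] seen) ⟨
      occLess a v + occ a (suc i ∷ seen)          ∎

elemᵇ-All≢ : ∀ {x w} → All (_≢ x) w → elemᵇ x w ≡ false
elemᵇ-All≢ []          = refl
elemᵇ-All≢ (a≢x ∷ h) rewrite ≢⇒≡ᵇ≡false (≢-sym a≢x) = elemᵇ-All≢ h

elemᵇ-++-∷ : ∀ x xs ys → elemᵇ x (xs ++ x ∷ ys) ≡ true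
elemᵇ-++-∷ x []       ys rewrite ≡ᵇ-refl x = refl
elemᵇ-++-∷ x (a ∷ xs) ys rewrite elemᵇ-++-∷ x xs ys = ∨-zeroʳ (x ≡ᵇ a)

blocked-All≢ : ∀ {i w} → All (_≢ i) w → blocked i w ≡ false
blocked-All≢ []                    = refl
blocked-All≢ {i} {a ∷ w} (_ ∷ h)
  rewrite elemᵇ-All≢ h | ∧-zeroʳ (a ≡ᵇ suc i) = blocked-All≢ h

blocked-raise : ∀ {i} xs {ys} → All (_≢ suc i) xs → All (_≢ i) ys → blocked i (xs ++ i ∷ ys) ≡ false
blocked-raise {i} [] [] no-i rewrite ≢⇒≡ᵇ≡false (≢-sym (1+n≢n {i})) = blocked-All≢ no-i
blocked-raise (a ∷ xs) (a≢1+i ∷ no-1+i) no-i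
  rewrite ≢⇒≡ᵇ≡false a≢1+i = blocked-raise xs no-1+i no-i

blocked-raise⁻ : ∀ i xs ys → blocked i (xs ++ i ∷ ys) ≡ false → All (_≢ suc i) xs
blocked-raise⁻ i []       ys _ = []
blocked-raise⁻ i (a ∷ xs) ys e with a ≡ᵇ suc i | ≡ᵇ-reflects a (suc i)
... | true  | _          = contradiction (trans (sym (elemᵇ-++-∷ i xs ys)) (∨-conicalˡ _ _ e)) λ ()
... | false | ofⁿ a≢1+i = a≢1+i ∷ blocked-raise⁻ i xs ys e

replaceLast-All≢ : ∀ {x} y {w} → All (_≢ x) w → replaceLast x y w ≡ nothing
replaceLast-All≢ y []                          = refl
replaceLast-All≢ y (a≢x ∷ h) rewrite replaceLast-All≢ y h | ≢⇒≡ᵇ≡false (≢-sym a≢x) = refl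

replaceLast≡nothing⇒All≢ : ∀ {x y} w → replaceLast x y w ≡ nothing → All (_≢ x) w
replaceLast≡nothing⇒All≢ []                   _ = []
replaceLast≡nothing⇒All≢ {x} {y} (a ∷ w) e with replaceLast x y w in e′
... | just _  = contradiction e λ ()
... | nothing with x ≡ᵇ a | ≡ᵇ-reflects x a
...   | true  | _        = contradiction e λ ()
...   | false | ofⁿ x≢a = ≢-sym x≢a ∷ replaceLast≡nothing⇒All≢ w e′

replaceLast-raise : ∀ x y xs {ys} → All (_≢ x) ys → replaceLast x y (xs ++ x ∷ ys) ≡ just (xs ++ y ∷ ys)
replaceLast-raise x y []       h rewrite replaceLast-All≢ y h | ≡ᵇ-refl x = refl
replaceLast-raise x y (a ∷ xs) h rewrite replaceLast-raise x y xs h = refl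

replaceLast≡just⇒ : ∀ {x y} w {w′} → replaceLast x y w ≡ just w′ →
                    ∃₂ λ xs ys → w ≡ xs ++ x ∷ ys × w′ ≡ xs ++ y ∷ ys × All (_≢ x) ys
replaceLast≡just⇒ {x} {y} (a ∷ w) e with replaceLast x y w in e′
replaceLast≡just⇒ (a ∷ w) refl | just _ with replaceLast≡just⇒ w e′
... | xs , ys , refl , refl , no-x = a ∷ xs , ys , refl , refl , no-x
replaceLast≡just⇒ {x} (a ∷ w) e | nothing with x ≡ᵇ a | ≡ᵇ-reflects x a
replaceLast≡just⇒ (a ∷ w) refl | nothing | true | ofʸ refl =
  [] , w , refl , refl , replaceLast≡nothing⇒All≢ w e′
replaceLast≡just⇒ (a ∷ w) ()   | nothing | false | _

Raise⇒qf≡just : ∀ {i u v} → Raise i u v → qf i u ≡ just v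
Raise⇒qf≡just {i} (raise xs ys no-1+i no-i)
  rewrite blocked-raise xs no-1+i no-i = replaceLast-raise i (suc i) xs no-i

qf≡just⇒Raise : ∀ {i u v} → qf i u ≡ just v → Raise i u v
qf≡just⇒Raise {i} {u} e with blocked i u in not-blocked
... | true  = contradiction e λ ()
... | false with replaceLast≡just⇒ u e
...   | xs , ys , refl , refl , no-i = raise xs ys (blocked-raise⁻ i xs ys not-blocked) no-i

std-Edge : ∀ {u v} → Edge u v → std u ≡ std v
std-Edge (_ , _ , _ , f̈ᵢu≡v) = std-Raise (qf≡just⇒Raise f̈ᵢu≡v)

std-SameComponent : ∀ {u v} → SameComponent u v → std u ≡ std v
std-SameComponent = gfold isEquivalence std std-Edge

insertAt : ℕ → ℕ → Word → Word
insertAt p h w = take p w ++ h ∷ drop p w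

insertAt-++ : ∀ xs ys h → insertAt (length xs) h (xs ++ ys) ≡ xs ++ h ∷ ys
insertAt-++ []       ys h = refl
insertAt-++ (x ∷ xs) ys h = cong (x ∷_) (insertAt-++ xs ys h)

length-insertAt : ∀ p h w → length (insertAt p h w) ≡ suc (length w)
length-insertAt zero    h w       = refl
length-insertAt (suc p) h []      = refl
length-insertAt (suc p) h (a ∷ w) = cong suc (length-insertAt p h w)

occ-insertAt : ∀ a p h w → occ a (insertAt p h w) ≡ occ a [ h ] + occ a w
occ-insertAt a p h w = begin
  occ a (take p w ++ h ∷ drop p w)                   ≡⟨ occ-++ a (take p w) (h ∷ drop p w) ⟩
  occ a (take p w) + occ a (h ∷ drop p w)            ≡⟨ cong (occ a (take p w) +_) (occ-++ a [ h ] (drop p w)) ⟩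
  occ a (take p w) + (occ a [ h ] + occ a (drop p w)) ≡⟨ x∙yz≈y∙xz (occ a (take p w)) (occ a [ h ]) _ ⟩
  occ a [ h ] + (occ a (take p w) + occ a (drop p w)) ≡⟨ cong (occ a [ h ] +_) (occ-++ a (take p w) (drop p w)) ⟨
  occ a [ h ] + occ a (take p w ++ drop p w)          ≡⟨ cong (λ w′ → occ a [ h ] + occ a w′) (take++drop≡id p w) ⟩
  occ a [ h ] + occ a w                               ∎
  where open ≡-Reasoning

All-insertAt : ∀ {P : ℕ → Set} p {h w} → P h → All P w → All P (insertAt p h w)
All-insertAt p Ph Pw = All.++⁺ (All.take⁺ p Pw) (Ph ∷ All.drop⁺ p Pw)

Raise-∷ : ∀ {i a u v} → a ≢ suc i → Raise i u v → Raise i (a ∷ u) (a ∷ v)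
Raise-∷ a≢1+i (raise xs ys no-1+i no-i) = raise (_ ∷ xs) ys (a≢1+i ∷ no-1+i) no-i

Raise-insertAt : ∀ {i h u v} p → h ≢ i → h ≢ suc i → Raise i u v →
                 Raise i (insertAt p h u) (insertAt p h v)
Raise-insertAt zero    _   h≢1+i r                         = Raise-∷ h≢1+i r
Raise-insertAt (suc p) h≢i _     (raise [] ys [] no-i)     = raise [] (insertAt p _ ys) [] (All-insertAt p h≢i no-i)
Raise-insertAt (suc p) h≢i h≢1+i (raise (x ∷ xs) ys (x≢1+i ∷ no-1+i) no-i) =
  Raise-∷ x≢1+i (Raise-insertAt p h≢i h≢1+i (raise xs ys no-1+i no-i))

Edge-insertAt : ∀ {u v} → Edge u v →
                ∃[ b ] ∀ p h → b ≤ h → Edge (insertAt p h u) (insertAt p h v)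
Edge-insertAt (wu , wv , i , f̈ᵢu≡v) = 2 + i , λ p h 2+i≤h →
  let 1≤h   = ≤-trans (s≤s z≤n) 2+i≤h
      h≢i   = >⇒≢ (≤-trans (n≤1+n (suc i)) 2+i≤h)
      h≢1+i = >⇒≢ 2+i≤h
  in All-insertAt p 1≤h wu , All-insertAt p 1≤h wv , i ,
     Raise⇒qf≡just (Raise-insertAt p h≢i h≢1+i (qf≡just⇒Raise f̈ᵢu≡v))

SymEdge-insertAt : ∀ {u v} → SymClosure Edge u v →
                   ∃[ b ] ∀ p h → b ≤ h → SymClosure Edge (insertAt p h u) (insertAt p h v)
SymEdge-insertAt (fwd e) with Edge-insertAt e
... | b , e′ = b , λ p h b≤h → fwd (e′ p h b≤h)
SymEdge-insertAt (bwd e) with Edge-insertAt e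
... | b , e′ = b , λ p h b≤h → bwd (e′ p h b≤h)

SameComponent-insertAt : ∀ {u v} → SameComponent u v →
                         ∃[ b ] ∀ p h → b ≤ h → SameComponent (insertAt p h u) (insertAt p h v)
SameComponent-insertAt ε = 0 , λ _ _ _ → ε
SameComponent-insertAt (e ◅ es) with SymEdge-insertAt e | SameComponent-insertAt es
... | b₁ , e′ | b₂ , es′ = b₁ ⊔ b₂ , λ p h b≤h →
  e′ p h (m⊔n≤o⇒m≤o b₁ b₂ b≤h) ◅ es′ p h (m⊔n≤o⇒n≤o b₁ b₂ b≤h)

SameComponent-raise : ∀ {xs ys c d} → IsWord xs → IsWord ys → 1 ≤ c →
                      All (_≤ c) xs → All (_< c) ys → c ≤ d →
                      SameComponent (xs ++ c ∷ ys) (xs ++ d ∷ ys)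
SameComponent-raise {xs} {ys} {c} wxs wys 1≤c xs≤c ys<c c≤d =
  subst (λ d → SameComponent (xs ++ c ∷ ys) (xs ++ d ∷ ys)) (m∸n+n≡m c≤d) (raise-by _)
  where
  raise-by : ∀ k → SameComponent (xs ++ c ∷ ys) (xs ++ k + c ∷ ys)
  raise-by zero    = ε
  raise-by (suc k) = raise-by k ◅◅ (fwd edge ◅ ε)
    where
    c≤k+c = m≤n+m c k
    edge : Edge (xs ++ k + c ∷ ys) (xs ++ suc k + c ∷ ys)
    edge = All.++⁺ wxs (≤-trans 1≤c c≤k+c ∷ wys) ,
           All.++⁺ wxs (≤-trans 1≤c (m≤n⇒m≤1+n c≤k+c) ∷ wys) , k + c ,
           Raise⇒qf≡just (raise xs ys (All-map (λ x≤c → <⇒≢ (s≤s (≤-trans x≤c c≤k+c))) xs≤c)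
                                      (All-map (λ y<c → <⇒≢ (<-≤-trans y<c c≤k+c)) ys<c))

-- Each of 1, …, k occurs once, so the letters below k + 1 are the zeros and k
-- more; at k = length t this leaves no room for zeros or for letters above k.
occLess-standard : ∀ t → IsStandard t → ∀ k → k ≤ length t → occLess (suc k) t ≡ occ 0 t + k
occLess-standard t st zero _ = begin
  occLess 1 t            ≡⟨ occLess-suc 0 t ⟩
  occLess 0 t + occ 0 t  ≡⟨ cong (_+ occ 0 t) (occLess-0 t) ⟩
  occ 0 t                ≡⟨ +-identityʳ _ ⟨
  occ 0 t + 0            ∎
  where open ≡-Reasoning
occLess-standard t st (suc k) 1+k≤n = begin
  occLess (suc (suc k)) t               ≡⟨ occLess-suc (suc k) t ⟩
  occLess (suc k) t + occ (suc k) t     ≡⟨ cong₂ _+_ (occLess-standard t st k (≤-trans (n≤1+n k) 1+k≤n))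
                                                     (st (suc k) (s≤s z≤n) 1+k≤n) ⟩
  occ 0 t + k + 1                       ≡⟨ +-assoc (occ 0 t) k 1 ⟩
  occ 0 t + (k + 1)                     ≡⟨ cong (occ 0 t +_) (+-comm k 1) ⟩
  occ 0 t + suc k                       ∎
  where open ≡-Reasoning

standard-no-0 : ∀ t → IsStandard t → occ 0 t ≡ 0
standard-no-0 t st = n≤0⇒n≡0 (+-cancelʳ-≤ n (occ 0 t) 0
  (subst (_≤ n) (occLess-standard t st n ≤-refl) (occLess≤length (suc n) t)))
  where n = length t

standard-IsWord : ∀ t → IsStandard t → IsWord t
standard-IsWord t st = All-map n≢0⇒n>0 (occ≡0⇒All≢ t (standard-no-0 t st))

standard-bounded : ∀ t → IsStandard t → All (_≤ length t) t
standard-bounded t st = All-map ≤-pred (occLess≡length⇒All< (suc n) t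
  (trans (occLess-standard t st n ≤-refl) (cong (_+ n) (standard-no-0 t st))))
  where n = length t

IsStandard-[] : IsStandard []
IsStandard-[] (suc _) _ ()

IsStandard-insertAt : ∀ p t → IsStandard t → IsStandard (insertAt p (suc (length t)) t)
IsStandard-insertAt p t st j 1≤j j≤1+n
  rewrite occ-insertAt j p (suc (length t)) t
  with m≤n⇒m<n∨m≡n (subst (j ≤_) (length-insertAt p (suc (length t)) t) j≤1+n)
... | inj₁ (s≤s j≤n) rewrite occ-∷-≢ [] (<⇒≢ (s≤s j≤n)) = st j 1≤j j≤n
... | inj₂ refl      rewrite occ-∷-self (suc (length t)) [] =
  cong suc (All≢⇒occ≡0 (All-map (λ a≤n → <⇒≢ (s≤s a≤n)) (standard-bounded t st)))

stdFrom-id : ∀ {t} seen w → (∀ {a} → a ∈ w → suc (occLess a t) ≡ a × occ a (w ʳ++ seen) ≡ 1) →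
             stdFrom t seen w ≡ w
stdFrom-id seen []      _     = refl
stdFrom-id {t} seen (b ∷ w) ranks = cong₂ _∷_ b-fixed (stdFrom-id (b ∷ seen) w (ranks ∘ there))
  where
  open ≡-Reasoning
  rank-b = ranks (here refl)
  unseen : occ b seen ≡ 0
  unseen = m+n≡0⇒n≡0 (occ b w) (suc-injective (begin
    suc (occ b w + occ b seen)   ≡⟨ +-suc (occ b w) _ ⟨
    occ b w + suc (occ b seen)   ≡⟨ cong (occ b w +_) (occ-∷-self b seen) ⟨
    occ b w + occ b (b ∷ seen)   ≡⟨ occ-ʳ++ b w (b ∷ seen) ⟨
    occ b (w ʳ++ b ∷ seen)       ≡⟨ proj₂ rank-b ⟩
    1                            ∎))
  b-fixed : suc (occLess b t + occ b seen) ≡ b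
  b-fixed = begin
    suc (occLess b t + occ b seen) ≡⟨ cong (λ n → suc (occLess b t + n)) unseen ⟩
    suc (occLess b t + 0)          ≡⟨ cong suc (+-identityʳ _) ⟩
    suc (occLess b t)              ≡⟨ proj₁ rank-b ⟩
    b                              ∎

std-standard : ∀ t → IsStandard t → std t ≡ t
std-standard t st = stdFrom-id [] t λ a∈t →
  rank-letter a∈t , trans (occ-ʳ++ _ t []) (trans (+-identityʳ _) (once a∈t))
  where
  letter-bounds = lookup (standard-bounded t st)
  once : ∀ {a} → a ∈ t → occ a t ≡ 1
  once a∈t = st _ (lookup (standard-IsWord t st) a∈t) (letter-bounds a∈t)
  rank-letter : ∀ {a} → a ∈ t → suc (occLess a t) ≡ a
  rank-letter {zero}  a∈t = contradiction (lookup (standard-IsWord t st) a∈t) λ ()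
  rank-letter {suc k} a∈t =
    cong suc (trans (occLess-standard t st k (≤-trans (n≤1+n k) (letter-bounds a∈t)))
                    (cong (_+ k) (standard-no-0 t st)))

std-determines-standard : ∀ {u v s t} → IsStandard s → IsStandard t →
                          SameComponent u s → SameComponent v t → std u ≡ std v → s ≡ t
std-determines-standard {u} {v} {s} {t} ss st u~s v~t std-u≡std-v = begin
  s     ≡⟨ std-standard s ss ⟨
  std s ≡⟨ std-SameComponent u~s ⟨
  std u ≡⟨ std-u≡std-v ⟩
  std v ≡⟨ std-SameComponent v~t ⟩
  std t ≡⟨ std-standard t st ⟩
  t     ∎
  where open ≡-Reasoning

data LastMax : Word → Set where
  lastMax : ∀ xs m ys → All (_≤ m) xs → All (_< m) ys → LastMax (xs ++ m ∷ ys)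

LastMax-∷ : ∀ a {w} → LastMax w → LastMax (a ∷ w)
LastMax-∷ a (lastMax xs m ys xs≤m ys<m) with a ≤? m
... | yes a≤m = lastMax (a ∷ xs) m ys (a≤m ∷ xs≤m) ys<m
... | no  a≰m = lastMax [] a (xs ++ m ∷ ys) []
  (All.++⁺ (All-map (λ x≤m → ≤-<-trans x≤m m<a) xs≤m) (m<a ∷ All-map (λ y<m → <-trans y<m m<a) ys<m))
  where m<a = ≰⇒> a≰m

lastMax-∷ : ∀ a w → LastMax (a ∷ w)
lastMax-∷ a []      = lastMax [] a [] [] []
lastMax-∷ a (b ∷ w) = LastMax-∷ a (lastMax-∷ b w)

SameComponent-insertMax : ∀ {xs m ys t} → IsWord (xs ++ m ∷ ys) → All (_≤ m) xs → All (_< m) ys →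
                          IsStandard t → SameComponent (xs ++ ys) t →
                          SameComponent (xs ++ m ∷ ys) (insertAt (length xs) (suc (length t)) t)
SameComponent-insertMax {xs} {m} {ys} {t} wu xs≤m ys<m st w′~t with SameComponent-insertAt w′~t
... | b , lift = begin
  xs ++ m ∷ ys             ≈⟨ SameComponent-raise wxs wys 1≤m xs≤m ys<m m≤h ⟩
  xs ++ h ∷ ys             ≡⟨ insertAt-++ xs ys h ⟨
  insertAt p h (xs ++ ys)  ≈⟨ lift p h b≤h ⟩
  insertAt p h t           ≈⟨ SameComponent-raise (All.take⁺ p wt) (All.drop⁺ p wt) (s≤s z≤n)
                                (All.take⁺ p (All-map m≤n⇒m≤1+n t≤n)) (All.drop⁺ p (All-map s≤s t≤n)) n<h ⟨
  insertAt p (suc n) t     ∎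
  where
  open import Relation.Binary.Reasoning.Setoid (setoid Edge)
  p = length xs
  n = length t
  h = m + b + suc n
  m≤h = ≤-trans (m≤m+n m b) (m≤m+n (m + b) (suc n))
  b≤h = ≤-trans (m≤n+m b m) (m≤m+n (m + b) (suc n))
  n<h = m≤n+m (suc n) (m + b)
  wxs = All.++⁻ˡ xs wu
  wys = tail (All.++⁻ʳ xs wu)
  1≤m = head (All.++⁻ʳ xs wu)
  wt  = standard-IsWord t st
  t≤n = standard-bounded t st

standard-in-component : ∀ u → IsWord u → ∃[ t ] IsStandard t × SameComponent u t
standard-in-component u = by-length (length u) u refl
  where
  by-length : ∀ n u → length u ≡ n → IsWord u → ∃[ t ] IsStandard t × SameComponent u t
  by-length _       []      _     _ = [] , IsStandard-[] , ε
  by-length (suc n) (a ∷ u) |au| wau = insert-max (lastMax-∷ a u) |au| wau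
    where
    insert-max : ∀ {w} → LastMax w → length w ≡ suc n → IsWord w →
                 ∃[ t ] IsStandard t × SameComponent w t
    insert-max (lastMax xs m ys xs≤m ys<m) |w| ww
      with by-length n (xs ++ ys) (suc-injective (trans (sym (length-++-sucʳ xs m ys)) |w|))
                     (All.++⁺ (All.++⁻ˡ xs ww) (tail (All.++⁻ʳ xs ww)))
    ... | t , st , w′~t = insertAt (length xs) (suc (length t)) t ,
                          IsStandard-insertAt (length xs) t st ,
                          SameComponent-insertMax ww xs≤m ys<m st w′~t

corollary1 : ((u : Word) → IsWord u →
                Σ Word (λ s → IsStandard s × SameComponent u s ×
                  ((t : Word) → IsStandard t → SameComponent u t → t ≡ s)))
             × ((u v : Word) → IsWord u → IsWord v →
                (SameComponent u v ⇔ (std u ≡ std v)))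
corollary1 = unique-standard , same-component⇔same-std
  where
  unique-standard : (u : Word) → IsWord u →
                    Σ Word (λ s → IsStandard s × SameComponent u s ×
                      ((t : Word) → IsStandard t → SameComponent u t → t ≡ s))
  unique-standard u wu with standard-in-component u wu
  ... | s , ss , u~s = s , ss , u~s , λ t st u~t → std-determines-standard st ss u~t u~s refl

  same-component⇔same-std : (u v : Word) → IsWord u → IsWord v → (SameComponent u v ⇔ (std u ≡ std v))
  same-component⇔same-std u v wu wv with standard-in-component u wu | standard-in-component v wv
  ... | s , ss , u~s | t , st , v~t = mk⇔ std-SameComponent λ std-u≡std-v →
    let s≡t = std-determines-standard ss st u~s v~t std-u≡std-v
    in transitive Edge u~s (subst (λ x → SameComponent x v) (sym s≡t) (symmetric Edge v~t))
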